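{- Suppose $\Delta\vdash M:A$ is a valid typing judgment, $\Delta'$ is a context with $\Delta'<:\Delta$, and $A'$ is a type with $A<:A'$. Then there exists an indexed term $M'$ such that $\Delta'\vdash M':A'$ is a valid typing judgment and $\mathrm{Erase}(M)=\mathrm{Erase}(M')$. Moreover, if $M$ is a value, then $M'$ is a value.
   Context: Types: $A,B ::= \alpha \mid (A\multimap B)\mid (A\otimes B)\mid \mathbf{1}\mid {!A}$, with $\alpha$ ranging over a fixed set of type constants; ${!^n}A$ denotes $A$ preceded by $n$ copies of $!$. Subtyping $<:$ is the least relation closed under the following rules, each usable whenever the integers $n,m\ge 0$ satisfy ($m=0$ or $n\ge 1$): ${!^n}\alpha<:{!^m}\alpha$; ${!^n}\mathbf{1}<:{!^m}\mathbf{1}$; if $A<:A'$ and $B<:B'$ then ${!^n}(A'\multimap B)<:{!^m}(A\multimap B')$; if $A<:A'$ and $B<:B'$ then ${!^n}(A\otimes B)<:{!^m}(A'\otimes B')$. For contexts, $\Delta'<:\Delta$ means $\Delta'$ and $\Delta$ have the same variables and $\Delta'(x)<:\Delta(x)$ for each variable $x$. Indexed terms ($n$ a nonnegative integer, $x,y$ variables, $c$ from a set of constants, each constant $c$ being assigned a type ${!A_c}$): core values $U ::= x^A \mid c^A \mid *^n \mid \lambda^n x^A.M$; values $V,W ::= U \mid \langle V,W\rangle^n \mid (\lambda^0x^A.W)V \mid \mathrm{let}\ \langle x^A,y^B\rangle^n=V\ \mathrm{in}\ W \mid \mathrm{let}\ *=V\ \mathrm{in}\ W$; terms $M,N ::=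 U\mid \langle M,N\rangle^n\mid MN\mid \mathrm{let}\ \langle x^A,y^B\rangle^n=M\ \mathrm{in}\ N\mid \mathrm{let}\ *=M\ \mathrm{in}\ N$. $\mathrm{Erase}(M)$ is the untyped term obtained from $M$ by removing all type annotations and all integer superscripts. A context is a finite list $x_1:A_1,\dots,x_k:A_k$ of distinct variables with types; $\Gamma,\Delta$ denotes juxtaposition of contexts with disjoint variables; ${!\Delta}$ denotes a context all of whose types are of the form ${!B}$. A typing judgment $\Delta\vdash M:A$ is valid if derivable by the rules: (ax1) ${!\Delta},x:A\vdash x^B:B$ if $A<:B$; (ax2) ${!\Delta}\vdash c^B:B$ if $A_c<:B$; (app) from $\Gamma_1,{!\Delta}\vdash M:A\multimap B$ and $\Gamma_2,{!\Delta}\vdash N:A$ infer $\Gamma_1,\Gamma_2,{!\Delta}\vdash MN:B$; ($\lambda_1$) from $\Delta,x:A\vdash M:B$ infer $\Delta\vdash\lambda^0x^A.M:A\multimap B$; ($\lambda_2$) from ${!\Delta},x:A\vdash M:B$ infer ${!\Delta}\vdash \lambda^{n+1}x^A.M:{!^{n+1}}(A\multimap B)$; ($\mathbf 1$.I) ${!\Delta}\vdash *^n:{!^n}\mathbf{1}$; ($\otimes$.I) from ${!\Delta},\Gamma_1\vdash M_1:{!^n}A_1$ and ${!\Delta},\Gamma_2\vdash M_2:{!^n}A_2$ infer ${!\Delta},\Gamma_1,\Gamma_2\vdash\langle M_1,M_2\rangle^n:{!^n}(A_1\otimes A_2)$; ($\mathbf 1$.E) from ${!\Delta},\Gamma_1\vdash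 M:\mathbf{1}$ and ${!\Delta},\Gamma_2\vdash N:A$ infer ${!\Delta},\Gamma_1,\Gamma_2\vdash \mathrm{let}\ *=M\ \mathrm{in}\ N:A$; ($\otimes$.E) from ${!\Delta},\Gamma_1\vdash M:{!^n}(A_1\otimes A_2)$ and ${!\Delta},\Gamma_2,x_1:{!^n}A_1,x_2:{!^n}A_2\vdash N:A$ infer ${!\Delta},\Gamma_1,\Gamma_2\vdash \mathrm{let}\ \langle x_1^{A_1},x_2^{A_2}\rangle^n=M\ \mathrm{in}\ N:A$. -}

module Defs where

open import Data.Nat using (ℕ; zero; suc; _≤_)
open import Data.Product using (Σ; _×_; _,_; proj₁; proj₂)
open import Data.Sum using (_⊎_)
open import Data.List using (List; []; _∷_; _++_; map)
open import Data.List.Relation.Unary.All using (All)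
open import Data.List.Relation.Unary.Unique.Propositional using (Unique)
open import Data.List.Relation.Binary.Permutation.Propositional using (_↭_)
open import Data.List.Relation.Binary.Pointwise using (Pointwise)
open import Relation.Binary.PropositionalEquality using (_≡_)

infixr 30 _⊸_
infixr 35 _⊗_

data Ty (TC : Set) : Set where
  tc  : TC → Ty TC
  _⊸_ : Ty TC → Ty TC → Ty TC
  _⊗_ : Ty TC → Ty TC → Ty TC
  𝟙   : Ty TC
  !_  : Ty TC → Ty TC

bang : {TC : Set} → ℕ → Ty TC → Ty TC
bang zero    A = A
bang (suc n) A = ! bang n A

SubCond : ℕ → ℕ → Set
SubCond n m = (m ≡ 0) ⊎ (1 ≤ n)

infix 4 _<:_
data _<:_ {TC : Set} : Ty TC → Ty TC → Set where
  sub-α : ∀ {n m} (α : TC) → SubCond n m → bang n (tc α) <: bang m (tc α)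
  sub-𝟙 : ∀ {n m} → SubCond n m → bang n 𝟙 <: bang m 𝟙
  sub-⊸ : ∀ {n m A A' B B'} → SubCond n m → A <: A' → B <: B' →
          bang n (A' ⊸ B) <: bang m (A ⊸ B')
  sub-⊗ : ∀ {n m A A' B B'} → SubCond n m → A <: A' → B <: B' →
          bang n (A ⊗ B) <: bang m (A' ⊗ B')

Var : Set
Var = ℕ

data Term (TC Const : Set) : Set where
  var   : Var → Ty TC → Term TC Const
  const : Const → Ty TC → Term TC Const
  star  : ℕ → Term TC Const                                 -- *^n
  lam   : ℕ → Var → Ty TC → Term TC Const → Term TC Const   -- λ^n x^A. M
  pair  : ℕ → Term TC Const → Term TC Const → Term TC Const -- ⟨M,N⟩^n
  app   : Term TC Const → Term TC Const → Term TC Const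
  letP  : ℕ → Var → Ty TC → Var → Ty TC →
          Term TC Const → Term TC Const → Term TC Const     -- let ⟨x^A,y^B⟩^n = M in N
  letU  : Term TC Const → Term TC Const → Term TC Const

data IsCoreValue {TC Const : Set} : Term TC Const → Set where
  cv-var   : ∀ {x A} → IsCoreValue (var x A)
  cv-const : ∀ {c A} → IsCoreValue (const c A)
  cv-star  : ∀ {n} → IsCoreValue (star n)
  cv-lam   : ∀ {n x A M} → IsCoreValue (lam n x A M)

data IsValue {TC Const : Set} : Term TC Const → Set where
  v-core : ∀ {U} → IsCoreValue U → IsValue U
  v-pair : ∀ {n V W} → IsValue V → IsValue W → IsValue (pair n V W)
  v-app  : ∀ {x A W V} → IsValue W → IsValue V → IsValue (app (lam 0 x A W) V)
  v-letP : ∀ {n x A y B V W} → IsValue V → IsValue W → IsValue (letP n x A y B V W)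
  v-letU : ∀ {V W} → IsValue V → IsValue W → IsValue (letU V W)

data UTerm (Const : Set) : Set where
  uvar   : Var → UTerm Const
  uconst : Const → UTerm Const
  ustar  : UTerm Const
  ulam   : Var → UTerm Const → UTerm Const
  upair  : UTerm Const → UTerm Const → UTerm Const
  uapp   : UTerm Const → UTerm Const → UTerm Const
  uletP  : Var → Var → UTerm Const → UTerm Const → UTerm Const
  uletU  : UTerm Const → UTerm Const → UTerm Const

erase : {TC Const : Set} → Term TC Const → UTerm Const
erase (var x A)            = uvar x
erase (const c A)          = uconst c
erase (star n)             = ustar
erase (lam n x A M)        = ulam x (erase M)
erase (pair n M N)         = upair (erase M) (erase N)
erase (app M N)            = uapp (erase M) (erase N)
erase (letP n x A y B M N) = uletP x y (erase M) (erase N)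
erase (letU M N)           = uletU (erase M) (erase N)

Ctx : Set → Set
Ctx TC = List (Var × Ty TC)

WF : {TC : Set} → Ctx TC → Set
WF Γ = Unique (map proj₁ Γ)

IsBang : {TC : Set} → Ty TC → Set
IsBang {TC} A = Σ (Ty TC) λ B → A ≡ ! B

BangCtx : {TC : Set} → Ctx TC → Set
BangCtx Δ = All (λ p → IsBang (proj₂ p)) Δ

CtxEntrySub : {TC : Set} → (Var × Ty TC) → (Var × Ty TC) → Set
CtxEntrySub (x' , A') (x , A) = (x' ≡ x) × (A' <: A)

infix 4 _<:ctx_
_<:ctx_ : {TC : Set} → Ctx TC → Ctx TC → Set
_<:ctx_ {TC} Δ' Δ = Σ (Ctx TC) λ Δ'' → (Δ' ↭ Δ'') × Pointwise CtxEntrySub Δ'' Δ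

-- Ac c is A_c, i.e. the constant c has type !A_c.
-- Contexts are lists with distinct variables; juxtaposition is list
-- concatenation and the conclusion context of each rule is taken up to
-- permutation (contexts are finite assignments of types to variables).

module Typing {TC Const : Set} (Ac : Const → Ty TC) where

  infix 3 _⊢_∶_
  data _⊢_∶_ : Ctx TC → Term TC Const → Ty TC → Set where
    ax1 : ∀ {Γ Δ x A B} → BangCtx Δ → A <: B →
          Γ ↭ (Δ ++ ((x , A) ∷ [])) → WF Γ →
          Γ ⊢ var x B ∶ B
    ax2 : ∀ {Δ c B} → BangCtx Δ → Ac c <: B → WF Δ →
          Δ ⊢ const c B ∶ B
    app : ∀ {Γ Γ₁ Γ₂ Δ M N A B} → BangCtx Δ →
          (Γ₁ ++ Δ) ⊢ M ∶ (A ⊸ B) → (Γ₂ ++ Δ) ⊢ N ∶ A →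
          Γ ↭ (Γ₁ ++ Γ₂ ++ Δ) → WF Γ →
          Γ ⊢ app M N ∶ B
    lam₁ : ∀ {Δ x A M B} →
          (Δ ++ ((x , A) ∷ [])) ⊢ M ∶ B → WF Δ →
          Δ ⊢ lam 0 x A M ∶ (A ⊸ B)
    lam₂ : ∀ {Δ x A M B n} → BangCtx Δ →
          (Δ ++ ((x , A) ∷ [])) ⊢ M ∶ B → WF Δ →
          Δ ⊢ lam (suc n) x A M ∶ bang (suc n) (A ⊸ B)
    𝟙I  : ∀ {Δ n} → BangCtx Δ → WF Δ →
          Δ ⊢ star n ∶ bang n 𝟙
    ⊗I  : ∀ {Γ Γ₁ Γ₂ Δ M₁ M₂ A₁ A₂ n} → BangCtx Δ →
          (Δ ++ Γ₁) ⊢ M₁ ∶ bang n A₁ → (Δ ++ Γ₂) ⊢ M₂ ∶ bang n A₂ →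
          Γ ↭ (Δ ++ Γ₁ ++ Γ₂) → WF Γ →
          Γ ⊢ pair n M₁ M₂ ∶ bang n (A₁ ⊗ A₂)
    𝟙E  : ∀ {Γ Γ₁ Γ₂ Δ M N A} → BangCtx Δ →
          (Δ ++ Γ₁) ⊢ M ∶ 𝟙 → (Δ ++ Γ₂) ⊢ N ∶ A →
          Γ ↭ (Δ ++ Γ₁ ++ Γ₂) → WF Γ →
          Γ ⊢ letU M N ∶ A
    ⊗E  : ∀ {Γ Γ₁ Γ₂ Δ M N A A₁ A₂ x₁ x₂ n} → BangCtx Δ →
          (Δ ++ Γ₁) ⊢ M ∶ bang n (A₁ ⊗ A₂) →
          ((Δ ++ Γ₂) ++ ((x₁ , bang n A₁) ∷ (x₂ , bang n A₂) ∷ [])) ⊢ N ∶ A →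
          Γ ↭ (Δ ++ Γ₁ ++ Γ₂) → WF Γ →
          Γ ⊢ letP n x₁ A₁ x₂ A₂ M N ∶ A

module Submission where

-- It rests on
--  * the normal form  !^n C  of types (C a core type), which makes
--    subtyping reflexive, transitive, stable under adding bangs, and
--    invertible at each core constructor;
--  * closure of !-types, well-formedness and splitting of contexts under
--    context subtyping, so every rule can be replayed in the subcontext;
--  * an invariant  PreservesValues M M'  which, besides value-hood, keeps
--    track of λ⁰-abstractions with value bodies, needed for the value
--    form  (λ⁰x.W) V.
-- In each rule, the target type is inverted to choose the new indices
-- and annotations, and the premises are re-annotated recursively.

open import Defs
open import Data.Empty using (⊥; ⊥-elim)
open import Data.Nat using (ℕ; zero; suc; _+_; s≤s; z≤n)
open import Data.Nat.Properties using (≤-trans; m≤m+n; m≤n+m)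
open import Data.Product using (Σ; _×_; _,_; proj₁; proj₂)
open import Data.Sum using (inj₁; inj₂)
open import Data.List using (List; []; _∷_; _++_; map)
open import Data.List.Relation.Unary.All using ([]; _∷_)
open import Data.List.Relation.Unary.Unique.Propositional using (Unique)
open import Data.List.Relation.Binary.Permutation.Propositional
  using (_↭_; refl; prep; swap; trans; ↭-sym; ↭⇒↭ₛ)
open import Data.List.Relation.Binary.Permutation.Propositional.Properties
  using (All-resp-↭; map⁺; ++⁺ʳ)
open import Data.List.Relation.Binary.Permutation.Setoid.Properties as PermutationSetoid
  using ()
open import Data.List.Relation.Binary.Pointwise using (Pointwise; []; _∷_; ++⁺)
open import Relation.Binary.PropositionalEquality
  using (_≡_; refl; sym; cong; cong₂; subst; subst₂; setoid)

-- Normal form of types: every type is  !^n C  for a unique n and a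
-- unique core type C (a type constant, 𝟙, an arrow or a tensor).

data Core {TC : Set} : Ty TC → Set where
  core-tc : ∀ α → Core (tc α)
  core-⊸  : ∀ {A B} → Core (A ⊸ B)
  core-⊗  : ∀ {A B} → Core (A ⊗ B)
  core-𝟙  : Core 𝟙

module _ {TC : Set} where

  core-not-! : ∀ {C B : Ty TC} → Core C → C ≡ ! B → ⊥
  core-not-! (core-tc _) ()
  core-not-! core-⊸ ()
  core-not-! core-⊗ ()
  core-not-! core-𝟙 ()

  !-injective : ∀ {A B : Ty TC} → ! A ≡ ! B → A ≡ B
  !-injective refl = refl

  -- Uniqueness of the normal form: the number of bangs and the core are
  -- determined by the type.  This is what makes rule inversion possible.
  bang-injective : ∀ {n m} {C D : Ty TC} → Core C → Core D →
    bang n C ≡ bang m D → (n ≡ m) × (C ≡ D)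
  bang-injective {zero}  {zero}  _ _ e = refl , e
  bang-injective {zero}  {suc m} c _ e = ⊥-elim (core-not-! c e)
  bang-injective {suc n} {zero}  _ d e = ⊥-elim (core-not-! d (sym e))
  bang-injective {suc n} {suc m} c d e with bang-injective {n} {m} c d (!-injective e)
  ... | refl , C≡D = refl , C≡D

  same-core : ∀ {n m} {C D : Ty TC} → Core C → Core D → bang n C ≡ bang m D → C ≡ D
  same-core c d e = proj₂ (bang-injective c d e)

  bang-+ : ∀ n k (C : Ty TC) → bang n (bang k C) ≡ bang (n + k) C
  bang-+ zero    k C = refl
  bang-+ (suc n) k C = cong !_ (bang-+ n k C)

SubCond-0 : ∀ {m} → SubCond 0 m → m ≡ 0
SubCond-0 (inj₁ m≡0) = m≡0
SubCond-0 (inj₂ ())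

SubCond-trans : ∀ {n m k} → SubCond n m → SubCond m k → SubCond n k
SubCond-trans (inj₂ 1≤n)  _ = inj₂ 1≤n
SubCond-trans (inj₁ refl) c = inj₁ (SubCond-0 c)

SubCond-+ : ∀ {n m k l} → SubCond n m → SubCond k l → SubCond (n + k) (m + l)
SubCond-+ {n} {k = k} (inj₂ 1≤n)  _           = inj₂ (≤-trans 1≤n (m≤m+n n k))
SubCond-+ {n} {k = k} (inj₁ refl) (inj₂ 1≤k)  = inj₂ (≤-trans 1≤k (m≤n+m k n))
SubCond-+             (inj₁ refl) (inj₁ refl) = inj₁ refl

module _ {TC : Set} where

  regroup : ∀ n k m l {C D : Ty TC} →
    bang (n + k) C <: bang (m + l) D → bang n (bang k C) <: bang m (bang l D)
  regroup n k m l = subst₂ _<:_ (sym (bang-+ n k _)) (sym (bang-+ m l _))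

  bang-<: : ∀ {n m} {A B : Ty TC} → SubCond n m → A <: B → bang n A <: bang m B
  bang-<: {n} {m} c (sub-α {k} {l} α c')    = regroup n k m l (sub-α α (SubCond-+ c c'))
  bang-<: {n} {m} c (sub-𝟙 {k} {l} c')      = regroup n k m l (sub-𝟙 (SubCond-+ c c'))
  bang-<: {n} {m} c (sub-⊸ {k} {l} c' a b) = regroup n k m l (sub-⊸ (SubCond-+ c c') a b)
  bang-<: {n} {m} c (sub-⊗ {k} {l} c' a b) = regroup n k m l (sub-⊗ (SubCond-+ c c') a b)

  <:-refl : (A : Ty TC) → A <: A
  <:-refl (tc α)  = sub-α {n = 0} {0} α (inj₁ refl)
  <:-refl 𝟙       = sub-𝟙 {n = 0} {0} (inj₁ refl)
  <:-refl (A ⊸ B) = sub-⊸ {n = 0} {0} (inj₁ refl) (<:-refl A) (<:-refl B)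
  <:-refl (A ⊗ B) = sub-⊗ {n = 0} {0} (inj₁ refl) (<:-refl A) (<:-refl B)
  <:-refl (! A)   = bang-<: {n = 1} {1} (inj₂ (s≤s z≤n)) (<:-refl A)

  -- Transitivity, by simultaneous induction on both derivations; the
  -- middle types are compared through their normal forms.
  <:-trans-via : ∀ {S T T' U : Ty TC} → S <: T → T' <: U → T ≡ T' → S <: U
  <:-trans-via (sub-α α c) (sub-α β c') e with bang-injective (core-tc α) (core-tc β) e
  ... | refl , refl = sub-α α (SubCond-trans c c')
  <:-trans-via (sub-𝟙 c) (sub-𝟙 c') e with bang-injective core-𝟙 core-𝟙 e
  ... | refl , refl = sub-𝟙 (SubCond-trans c c')
  <:-trans-via (sub-⊸ c a b) (sub-⊸ c' a' b') e with bang-injective core-⊸ core-⊸ e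
  ... | refl , refl = sub-⊸ (SubCond-trans c c') (<:-trans-via a' a refl) (<:-trans-via b b' refl)
  <:-trans-via (sub-⊗ c a b) (sub-⊗ c' a' b') e with bang-injective core-⊗ core-⊗ e
  ... | refl , refl = sub-⊗ (SubCond-trans c c') (<:-trans-via a a' refl) (<:-trans-via b b' refl)
  <:-trans-via (sub-α α _)   (sub-𝟙 _)     e with () ← same-core (core-tc α) core-𝟙 e
  <:-trans-via (sub-α α _)   (sub-⊸ _ _ _) e with () ← same-core (core-tc α) core-⊸ e
  <:-trans-via (sub-α α _)   (sub-⊗ _ _ _) e with () ← same-core (core-tc α) core-⊗ e
  <:-trans-via (sub-𝟙 _)     (sub-α β _)   e with () ← same-core core-𝟙 (core-tc β) e
  <:-trans-via (sub-𝟙 _)     (sub-⊸ _ _ _) e with () ← same-core core-𝟙 core-⊸ e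
  <:-trans-via (sub-𝟙 _)     (sub-⊗ _ _ _) e with () ← same-core core-𝟙 core-⊗ e
  <:-trans-via (sub-⊸ _ _ _) (sub-α β _)   e with () ← same-core core-⊸ (core-tc β) e
  <:-trans-via (sub-⊸ _ _ _) (sub-𝟙 _)     e with () ← same-core core-⊸ core-𝟙 e
  <:-trans-via (sub-⊸ _ _ _) (sub-⊗ _ _ _) e with () ← same-core core-⊸ core-⊗ e
  <:-trans-via (sub-⊗ _ _ _) (sub-α β _)   e with () ← same-core core-⊗ (core-tc β) e
  <:-trans-via (sub-⊗ _ _ _) (sub-𝟙 _)     e with () ← same-core core-⊗ core-𝟙 e
  <:-trans-via (sub-⊗ _ _ _) (sub-⊸ _ _ _) e with () ← same-core core-⊗ core-⊸ e

  <:-trans : ∀ {S T U : Ty TC} → S <: T → T <: U → S <: U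
  <:-trans p q = <:-trans-via p q refl

  -- Each is proved by a local 'go' generalised over the left-hand type,
  -- so that the derivation can be matched on.

  inv-𝟙 : ∀ {n} {T : Ty TC} → bang n 𝟙 <: T → Σ ℕ λ m → T ≡ bang m 𝟙
  inv-𝟙 s = go s refl
    where
    go : ∀ {n} {S T : Ty TC} → S <: T → S ≡ bang n 𝟙 → Σ ℕ λ m → T ≡ bang m 𝟙
    go (sub-𝟙 {m = m} _) _ = m , refl
    go (sub-α α _)   e with () ← same-core (core-tc α) core-𝟙 e
    go (sub-⊸ _ _ _) e with () ← same-core core-⊸ core-𝟙 e
    go (sub-⊗ _ _ _) e with () ← same-core core-⊗ core-𝟙 e

  ⊸-Super : ℕ → Ty TC → Ty TC → Ty TC → Set
  ⊸-Super n A B T = Σ ℕ λ m → Σ (Ty TC) λ X → Σ (Ty TC) λ Y →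
    (T ≡ bang m (X ⊸ Y)) × (X <: A) × (B <: Y) × SubCond n m

  inv-⊸ : ∀ {n} {A B T : Ty TC} → bang n (A ⊸ B) <: T → ⊸-Super n A B T
  inv-⊸ s = go s refl
    where
    go : ∀ {n} {A B S T : Ty TC} → S <: T → S ≡ bang n (A ⊸ B) → ⊸-Super n A B T
    go (sub-⊸ c a b) e with bang-injective core-⊸ core-⊸ e
    ... | refl , refl = _ , _ , _ , refl , a , b , c
    go (sub-α α _)   e with () ← same-core (core-tc α) core-⊸ e
    go (sub-𝟙 _)     e with () ← same-core core-𝟙 core-⊸ e
    go (sub-⊗ _ _ _) e with () ← same-core core-⊗ core-⊸ e

  ⊗-Super : ℕ → Ty TC → Ty TC → Ty TC → Set
  ⊗-Super n A B T = Σ ℕ λ m → Σ (Ty TC) λ X → Σ (Ty TC) λ Y →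
    (T ≡ bang m (X ⊗ Y)) × (A <: X) × (B <: Y) × SubCond n m

  inv-⊗ : ∀ {n} {A B T : Ty TC} → bang n (A ⊗ B) <: T → ⊗-Super n A B T
  inv-⊗ s = go s refl
    where
    go : ∀ {n} {A B S T : Ty TC} → S <: T → S ≡ bang n (A ⊗ B) → ⊗-Super n A B T
    go (sub-⊗ c a b) e with bang-injective core-⊗ core-⊗ e
    ... | refl , refl = _ , _ , _ , refl , a , b , c
    go (sub-α α _)   e with () ← same-core (core-tc α) core-⊗ e
    go (sub-𝟙 _)     e with () ← same-core core-𝟙 core-⊗ e
    go (sub-⊸ _ _ _) e with () ← same-core core-⊸ core-⊗ e

  SubCond-IsBang : ∀ {n m} {C D : Ty TC} → Core D → SubCond n m →
    IsBang (bang m D) → IsBang (bang n C)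
  SubCond-IsBang {m = zero}  d _ (_ , e) = ⊥-elim (core-not-! d e)
  SubCond-IsBang {suc n} {suc m} {C} _ _ _ = bang n C , refl
  SubCond-IsBang {zero}  {suc m} _ (inj₁ ()) _
  SubCond-IsBang {zero}  {suc m} _ (inj₂ ()) _

  <:-IsBang : ∀ {S T : Ty TC} → S <: T → IsBang T → IsBang S
  <:-IsBang (sub-α α c)   = SubCond-IsBang (core-tc α) c
  <:-IsBang (sub-𝟙 c)     = SubCond-IsBang core-𝟙 c
  <:-IsBang (sub-⊸ c _ _) = SubCond-IsBang core-⊸ c
  <:-IsBang (sub-⊗ c _ _) = SubCond-IsBang core-⊗ c

module _ {X Y : Set} {R : X → Y → Set} where

  Pointwise-↭ : ∀ {xs ys zs} → Pointwise R xs ys → ys ↭ zs →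
    Σ (List X) λ ws → (xs ↭ ws) × Pointwise R ws zs
  Pointwise-↭ {xs} rs refl = xs , refl , rs
  Pointwise-↭ (_∷_ {x = x} r rs) (prep _ p) with Pointwise-↭ rs p
  ... | ws , q , rs' = x ∷ ws , prep x q , r ∷ rs'
  Pointwise-↭ (_∷_ {x = x₁} r₁ (_∷_ {x = x₂} r₂ rs)) (swap _ _ p) with Pointwise-↭ rs p
  ... | ws , q , rs' = x₂ ∷ x₁ ∷ ws , swap x₁ x₂ q , r₂ ∷ r₁ ∷ rs'
  Pointwise-↭ rs (trans p₁ p₂) with Pointwise-↭ rs p₁
  ... | ws , q₁ , rs₁ with Pointwise-↭ rs₁ p₂
  ... | vs , q₂ , rs₂ = vs , trans q₁ q₂ , rs₂

  Pointwise-++⁻ : ∀ (ys : List Y) {zs xs} → Pointwise R xs (ys ++ zs) →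
    Σ (List X) λ xs₁ → Σ (List X) λ xs₂ →
      (xs ≡ xs₁ ++ xs₂) × Pointwise R xs₁ ys × Pointwise R xs₂ zs
  Pointwise-++⁻ []       {xs = xs} rs = [] , xs , refl , [] , rs
  Pointwise-++⁻ (y ∷ ys) (_∷_ {x = x} r rs) with Pointwise-++⁻ ys rs
  ... | xs₁ , xs₂ , refl , rs₁ , rs₂ = x ∷ xs₁ , xs₂ , refl , r ∷ rs₁ , rs₂

module _ {TC : Set} where

  Entrywise : Ctx TC → Ctx TC → Set
  Entrywise = Pointwise CtxEntrySub

  Entrywise-refl : (Δ : Ctx TC) → Entrywise Δ Δ
  Entrywise-refl []      = []
  Entrywise-refl (e ∷ Δ) = (refl , <:-refl (proj₂ e)) ∷ Entrywise-refl Δ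

  Entrywise⇒<:ctx : ∀ {Δ' Δ : Ctx TC} → Entrywise Δ' Δ → Δ' <:ctx Δ
  Entrywise⇒<:ctx {Δ'} es = Δ' , refl , es

  Entrywise-vars : ∀ {Δ' Δ : Ctx TC} → Entrywise Δ' Δ → map proj₁ Δ' ≡ map proj₁ Δ
  Entrywise-vars []              = refl
  Entrywise-vars ((x≡ , _) ∷ es) = cong₂ _∷_ x≡ (Entrywise-vars es)

  Entrywise-BangCtx : ∀ {Δ' Δ : Ctx TC} → Entrywise Δ' Δ → BangCtx Δ → BangCtx Δ'
  Entrywise-BangCtx []              []       = []
  Entrywise-BangCtx ((_ , s) ∷ es) (b ∷ bs) = <:-IsBang s b ∷ Entrywise-BangCtx es bs

  <:ctx-WF : ∀ {Δ' Δ : Ctx TC} → Δ' <:ctx Δ → WF Δ → WF Δ'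
  <:ctx-WF (_ , p , es) u =
    PermutationSetoid.Unique-resp-↭ (setoid Var) (↭⇒↭ₛ (↭-sym (map⁺ proj₁ p)))
      (subst Unique (sym (Entrywise-vars es)) u)

  <:ctx-BangCtx : ∀ {Δ' Δ : Ctx TC} → Δ' <:ctx Δ → BangCtx Δ → BangCtx Δ'
  <:ctx-BangCtx (_ , p , es) b = All-resp-↭ (↭-sym p) (Entrywise-BangCtx es b)

  <:ctx-++ : ∀ {Δ' Δ E' E : Ctx TC} → Δ' <:ctx Δ → Entrywise E' E → (Δ' ++ E') <:ctx (Δ ++ E)
  <:ctx-++ {E' = E'} (Δ'' , p , es) es' = Δ'' ++ E' , ++⁺ʳ E' p , ++⁺ es es'

  <:ctx-split : ∀ {Δ' Γ : Ctx TC} (A B : Ctx TC) → Δ' <:ctx Γ → Γ ↭ (A ++ B) →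
    Σ (Ctx TC) λ A' → Σ (Ctx TC) λ B' →
      (Δ' ↭ (A' ++ B')) × Entrywise A' A × Entrywise B' B
  <:ctx-split A B (_ , p , es) q with Pointwise-↭ es q
  ... | _ , p' , es' with Pointwise-++⁻ A es'
  ... | A' , B' , refl , esA , esB = A' , B' , trans p p' , esA , esB

  <:ctx-split₃ : ∀ {Δ' Γ : Ctx TC} (A B C : Ctx TC) → Δ' <:ctx Γ → Γ ↭ (A ++ B ++ C) →
    Σ (Ctx TC) λ A' → Σ (Ctx TC) λ B' → Σ (Ctx TC) λ C' →
      (Δ' ↭ (A' ++ B' ++ C')) × Entrywise A' A × Entrywise B' B × Entrywise C' C
  <:ctx-split₃ A B C sc q with <:ctx-split A (B ++ C) sc q
  ... | A' , BC' , p , esA , esBC with Pointwise-++⁻ B esBC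
  ... | B' , C' , refl , esB , esC = A' , B' , C' , p , esA , esB , esC

-- A term  M N  is a value
-- exactly when M is a λ⁰-abstraction with a value body and N is a value,
-- so besides value-hood we must also track this shape.

module _ {TC Const : Set} where

  data IsValueLam₀ : Term TC Const → Set where
    value-lam₀ : ∀ {x A W} → IsValue W → IsValueLam₀ (lam 0 x A W)

  app-value : ∀ {M N : Term TC Const} → IsValueLam₀ M → IsValue N → IsValue (app M N)
  app-value (value-lam₀ w) v = v-app w v

  record PreservesValues (M M' : Term TC Const) : Set where
    field
      on-value : IsValue M → IsValue M'
      on-lam₀  : IsValueLam₀ M → IsValueLam₀ M'
  open PreservesValues

  core-pv : ∀ {M M' : Term TC Const} → (IsValueLam₀ M → ⊥) → IsCoreValue M' → PreservesValues M M'
  core-pv _        c .on-value _ = v-core c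
  core-pv not-lam₀ _ .on-lam₀ l  = ⊥-elim (not-lam₀ l)

  lam₀-pv : ∀ {x A A' W W'} → PreservesValues W W' →
    PreservesValues (lam 0 x A W) (lam 0 x A' W')
  lam₀-pv _  .on-value _              = v-core cv-lam
  lam₀-pv pW .on-lam₀ (value-lam₀ w) = value-lam₀ (on-value pW w)

  app-pv : ∀ {M N M' N'} → PreservesValues M M' → PreservesValues N N' →
    PreservesValues (app M N) (app M' N')
  app-pv pM pN .on-value (v-core ())
  app-pv pM pN .on-value (v-app w v) = app-value (on-lam₀ pM (value-lam₀ w)) (on-value pN v)
  app-pv pM pN .on-lam₀ ()

  pair-pv : ∀ {n m M N M' N'} → PreservesValues M M' → PreservesValues N N' →
    PreservesValues (pair n M N) (pair m M' N')
  pair-pv pM pN .on-value (v-core ())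
  pair-pv pM pN .on-value (v-pair v w) = v-pair (on-value pM v) (on-value pN w)
  pair-pv pM pN .on-lam₀ ()

  letU-pv : ∀ {M N M' N'} → PreservesValues M M' → PreservesValues N N' →
    PreservesValues (letU M N) (letU M' N')
  letU-pv pM pN .on-value (v-core ())
  letU-pv pM pN .on-value (v-letU v w) = v-letU (on-value pM v) (on-value pN w)
  letU-pv pM pN .on-lam₀ ()

  letP-pv : ∀ {n x A y B M N M' N'} → PreservesValues M M' → PreservesValues N N' →
    PreservesValues (letP n x A y B M N) (letP n x A y B M' N')
  letP-pv pM pN .on-value (v-core ())
  letP-pv pM pN .on-value (v-letP v w) = v-letP (on-value pM v) (on-value pN w)
  letP-pv pM pN .on-lam₀ ()

module Reannotation {TC Const : Set} (Ac : Const → Ty TC) where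
  open Typing Ac

  Reannotates : Ctx TC → Term TC Const → Ty TC → Set
  Reannotates Δ' M A' = Σ (Term TC Const) λ M' →
    (Δ' ⊢ M' ∶ A') × (erase M ≡ erase M') × PreservesValues M M'

  reannotate : ∀ {Δ Δ' M A A'} → Δ ⊢ M ∶ A → Δ' <:ctx Δ → A <: A' → Reannotates Δ' M A'
  reannotate {A' = A'} (ax1 {Δ = Δ} {x = x} {A = A} bΔ A<:B perm wf) sc B<:A'
    with <:ctx-split Δ ((x , A) ∷ []) sc perm
  ... | _ , _ ∷ [] , perm' , esΔ , (refl , X<:A) ∷ [] =
    var x A' , ax1 (Entrywise-BangCtx esΔ bΔ) (<:-trans X<:A (<:-trans A<:B B<:A')) perm' (<:ctx-WF sc wf) ,
    refl , core-pv (λ ()) cv-var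
  reannotate {A' = A'} (ax2 {c = c} bΔ Ac<:B wf) sc B<:A' =
    const c A' , ax2 (<:ctx-BangCtx sc bΔ) (<:-trans Ac<:B B<:A') (<:ctx-WF sc wf) ,
    refl , core-pv (λ ()) cv-const
  reannotate (app {Γ₁ = Γ₁} {Γ₂} {Δ} {A = A} bΔ dM dN perm wf) sc B<:B'
    with <:ctx-split₃ Γ₁ Γ₂ Δ sc perm
  ... | _ , _ , _ , perm' , es₁ , es₂ , esΔ
    with reannotate dM (Entrywise⇒<:ctx (++⁺ es₁ esΔ)) (sub-⊸ {n = 0} {0} (inj₁ refl) (<:-refl A) B<:B')
       | reannotate dN (Entrywise⇒<:ctx (++⁺ es₂ esΔ)) (<:-refl A)
  ... | M' , dM' , eM , pM | N' , dN' , eN , pN =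
    app M' N' , app (Entrywise-BangCtx esΔ bΔ) dM' dN' perm' (<:ctx-WF sc wf) ,
    cong₂ uapp eM eN , app-pv pM pN
  reannotate (lam₁ {x = x} dM wf) sc A⊸B<:T with inv-⊸ {n = 0} A⊸B<:T
  ... | m , X , Y , refl , X<:A , B<:Y , c with refl ← SubCond-0 c
    with reannotate dM (<:ctx-++ sc ((refl , X<:A) ∷ [])) B<:Y
  ... | W' , dW' , eW , pW = lam 0 x X W' , lam₁ dW' (<:ctx-WF sc wf) , cong (ulam x) eW , lam₀-pv pW
  reannotate {Δ' = Δ'} (lam₂ {x = x} {n = n} bΔ dM wf) sc A⊸B<:T with inv-⊸ {n = suc n} A⊸B<:T
  ... | m , X , Y , refl , X<:A , B<:Y , _ with reannotate dM (<:ctx-++ sc ((refl , X<:A) ∷ [])) B<:Y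
  ... | W' , dW' , eW , _ = lam m x X W' , lamᵐ m , cong (ulam x) eW , core-pv (λ ()) cv-lam
    where
    -- with no bang left the abstraction is typed by the linear rule
    lamᵐ : ∀ m → Δ' ⊢ lam m x X W' ∶ bang m (X ⊸ Y)
    lamᵐ zero    = lam₁ dW' (<:ctx-WF sc wf)
    lamᵐ (suc m) = lam₂ (<:ctx-BangCtx sc bΔ) dW' (<:ctx-WF sc wf)
  reannotate (𝟙I {n = n} bΔ wf) sc 𝟙<:T with inv-𝟙 {n = n} 𝟙<:T
  ... | m , refl = star m , 𝟙I (<:ctx-BangCtx sc bΔ) (<:ctx-WF sc wf) , refl , core-pv (λ ()) cv-star
  reannotate (⊗I {Γ₁ = Γ₁} {Γ₂} {Δ} {n = n} bΔ d₁ d₂ perm wf) sc ⊗<:T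
    with <:ctx-split₃ Δ Γ₁ Γ₂ sc perm | inv-⊗ {n = n} ⊗<:T
  ... | _ , _ , _ , perm' , esΔ , es₁ , es₂ | m , X₁ , X₂ , refl , A₁<:X₁ , A₂<:X₂ , c
    with reannotate d₁ (Entrywise⇒<:ctx (++⁺ esΔ es₁)) (bang-<: c A₁<:X₁)
       | reannotate d₂ (Entrywise⇒<:ctx (++⁺ esΔ es₂)) (bang-<: c A₂<:X₂)
  ... | M₁ , d₁' , e₁ , p₁ | M₂ , d₂' , e₂ , p₂ =
    pair m M₁ M₂ , ⊗I (Entrywise-BangCtx esΔ bΔ) d₁' d₂' perm' (<:ctx-WF sc wf) ,
    cong₂ upair e₁ e₂ , pair-pv p₁ p₂
  reannotate (𝟙E {Γ₁ = Γ₁} {Γ₂} {Δ} bΔ dM dN perm wf) sc A<:A'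
    with <:ctx-split₃ Δ Γ₁ Γ₂ sc perm
  ... | _ , _ , _ , perm' , esΔ , es₁ , es₂
    with reannotate dM (Entrywise⇒<:ctx (++⁺ esΔ es₁)) (<:-refl 𝟙)
       | reannotate dN (Entrywise⇒<:ctx (++⁺ esΔ es₂)) A<:A'
  ... | M' , dM' , eM , pM | N' , dN' , eN , pN =
    letU M' N' , 𝟙E (Entrywise-BangCtx esΔ bΔ) dM' dN' perm' (<:ctx-WF sc wf) ,
    cong₂ uletU eM eN , letU-pv pM pN
  reannotate (⊗E {Γ₁ = Γ₁} {Γ₂} {Δ} {A₁ = A₁} {A₂} {x₁} {x₂} {n} bΔ dM dN perm wf) sc A<:A'
    with <:ctx-split₃ Δ Γ₁ Γ₂ sc perm
  ... | _ , _ , _ , perm' , esΔ , es₁ , es₂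
    with reannotate dM (Entrywise⇒<:ctx (++⁺ esΔ es₁)) (<:-refl (bang n (A₁ ⊗ A₂)))
       | reannotate dN (Entrywise⇒<:ctx (++⁺ (++⁺ esΔ es₂) (Entrywise-refl _))) A<:A'
  ... | M' , dM' , eM , pM | N' , dN' , eN , pN =
    letP n x₁ A₁ x₂ A₂ M' N' , ⊗E (Entrywise-BangCtx esΔ bΔ) dM' dN' perm' (<:ctx-WF sc wf) ,
    cong₂ (uletP x₁ x₂) eM eN , letP-pv pM pN

mainTheorem5 : {TC Const : Set} (Ac : Const → Ty TC)
    {Δ Δ' : Ctx TC} {M : Term TC Const} {A A' : Ty TC} →
    Typing._⊢_∶_ Ac Δ M A → Δ' <:ctx Δ → A <: A' →
    Σ (Term TC Const) (λ M' →
    Typing._⊢_∶_ Ac Δ' M' A' × (erase M ≡ erase M') × (IsValue M → IsValue M'))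
mainTheorem5 Ac d sc s with Reannotation.reannotate Ac d sc s
... | M' , d' , erasure , preserves = M' , d' , erasure , PreservesValues.on-value preserves
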